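{- Let $n=4m>1$ and let $H$ be an $n\times n$ circulant Hadamard matrix with defining row $H_1$. Let $|\mathcal{B}_2|$ be the number of blocks of size $2$ in $H_1$ and $\alpha_1$ the number of $1$-alternating sequences in $H_1$. Then $|\mathcal{B}_2|+\alpha_1=m$.
   Context: A Hadamard matrix is an $n\times n$ matrix with entries in $\{+1,-1\}$ whose rows are mutually orthogonal. It is circulant if, writing its first row (the defining row) as $H_1=(h_1,\ldots,h_n)$, its $i$-th row is $H_i=(h_{1-i+1},\ldots,h_{n-i+1})$ with subscripts taken modulo $n$. Regard $H_1$ as a circular (cyclic) sequence of $+1$'s and $-1$'s. A block is a maximal set of cyclically consecutive entries of $H_1$ that are all equal; its size is its number of entries. Thus $H_1$ decomposes into a cyclic sequence of blocks of alternating sign. A $1$-alternating sequence is a maximal run of cyclically consecutive blocks all of size exactly $1$. -}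

module Defs where

import Data.Nat as ℕ
open import Data.Nat using (ℕ; zero; suc; NonZero; _+_; _∸_)
open import Data.Nat.DivMod using (_%_; m%n<n)
open import Data.Integer using (ℤ; +_; -_) renaming (_+_ to _+ℤ_; _*_ to _*ℤ_)
import Data.Integer as ℤ
open import Data.Fin using (Fin; toℕ; fromℕ<)
open import Data.List using (List; foldr; map; filter; length; allFin)
open import Data.Bool using (Bool; true; false; not; _∧_; if_then_else_)
open import Relation.Nullary.Decidable using (does; ⌊_⌋)
open import Relation.Unary using (Decidable)
open import Data.Bool.Properties using (T?)
open import Data.List.Relation.Unary.All using (All)
open import Data.Bool using (T)
open import Relation.Binary.PropositionalEquality using (_≡_; _≢_)
open import Data.Sum using (_⊎_)
open import Data.Product using (_×_)

Σℤ : (n : ℕ) → (Fin n → ℤ) → ℤ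
Σℤ n f = foldr _+ℤ_ (+ 0) (map f (allFin n))

count : (n : ℕ) → (Fin n → Bool) → ℕ
count n p = length (filter (λ i → T? (p i)) (allFin n))

-- Cyclic index: entry at position x taken modulo n (0-indexed).
at : (n : ℕ) .{{_ : NonZero n}} → (Fin n → ℤ) → ℕ → ℤ
at n h x = h (fromℕ< (m%n<n x n))

-- The circulant matrix with defining (first) row h:
-- H i j = h_{j - i mod n}  (0-indexed form of H_i = (h_{1-i+1}, …, h_{n-i+1})).
circ : (n : ℕ) .{{_ : NonZero n}} → (Fin n → ℤ) → Fin n → Fin n → ℤ
circ n h i j = at n h (toℕ j + (n ∸ toℕ i))

RowsOrthogonal : (n : ℕ) → (Fin n → Fin n → ℤ) → Set
RowsOrthogonal n H = ∀ (i k : Fin n) → i ≢ k → Σℤ n (λ j → H i j *ℤ H k j) ≡ + 0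

PlusMinusOne : (n : ℕ) → (Fin n → ℤ) → Set
PlusMinusOne n h = ∀ (j : Fin n) → h j ≡ + 1 ⊎ h j ≡ - (+ 1)

IsCirculantHadamard : (n : ℕ) .{{_ : NonZero n}} → (Fin n → ℤ) → Set
IsCirculantHadamard n h = PlusMinusOne n h × RowsOrthogonal n (circ n h)

module Blocks (n : ℕ) .{{_ : NonZero n}} (h : Fin n → ℤ) where

  differ : ℕ → ℕ → Bool
  differ x y = not (does (at n h x ℤ.≟ at n h y))

  -- position x (mod n) is the first entry of a block: it differs from its cyclic predecessor
  isStart : ℕ → Bool
  isStart x = differ x (x + (n ∸ 1))

  size2At : ℕ → Bool
  size2At x = isStart x ∧ not (isStart (x + 1)) ∧ isStart (x + 2)

  size1At : ℕ → Bool
  size1At x = isStart x ∧ isStart (x + 1)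

  -- x is the first block of a 1-alternating sequence: size-1 block at x whose
  -- cyclically preceding block does not have size 1
  altStartAt : ℕ → Bool
  altStartAt x = size1At x ∧ not (size1At (x + (n ∸ 1)))

  numBlocks2 : ℕ
  numBlocks2 = count n (λ i → size2At (toℕ i))

  -- α_1 : number of 1-alternating sequences.  If every block has size 1 the
  -- whole cycle is a single 1-alternating sequence.
  alpha1 : ℕ
  alpha1 = if does (count n (λ i → size1At (toℕ i)) ℕ.≟ n)
             then 1
             else count n (λ i → altStartAt (toℕ i))

{-# OPTIONS --safe #-}
module Submission where

-- For signs a, b, c ∈ {±1}, (1 − ab)(1 − bc) = 4·[a ≠ b]·[b ≠ c].  Taking a, b, c to be
-- h x, h (x + p), h (x + p + q) and summing over x gives
--   4·#{x | h x ≠ h (x + p) ≠ h (x + p + q)} = n + R (p + q) − R p − R q,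
-- where R k = Σₓ h x · h (x + k) is the periodic autocorrelation; it vanishes for 0 < k < n
-- because the first row of the circulant matrix is orthogonal to the others.  As n ≥ 4,
-- both (p, q) = (1, 1) and (p, q) = (2, 1) yield the count n/4.  For (1, 1) this counts the
-- blocks of size 1, so not every block has size 1 and α₁ counts the first blocks of
-- 1-alternating sequences.  For (2, 1) it counts the starts of blocks of size 2
-- (h x ≠ h (x + 1) = h (x + 2) ≠ h (x + 3)) together with those first blocks, shifted by one
-- (h x = h (x + 1) ≠ h (x + 2) ≠ h (x + 3)); hence 4 (|B₂| + α₁) = n.

open import Defs
open import Data.Nat using (ℕ; NonZero; _*_; _+_; _<_)
open import Data.Integer using (ℤ)
open import Data.Fin using (Fin)
open import Relation.Binary.PropositionalEquality using (_≡_)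

open import Data.Bool using (Bool; true; false; not; _∧_; _xor_; if_then_else_)
open import Data.Bool.Properties using (T?)
open import Data.Fin using (zero; suc; toℕ; fromℕ; fromℕ<; inject₁)
open import Data.Fin.Properties using (fromℕ<-cong; toℕ-fromℕ; toℕ-fromℕ<; toℕ-inject₁)
open import Data.Integer using (+_; -_; _≟_) renaming (_+_ to _+ℤ_; _*_ to _*ℤ_)
open import Data.List using (foldr; filter; length; tabulate)
open import Data.List.Properties using (map-tabulate)
open import Data.Nat using (zero; suc; _∸_; _≤_; s≤s; z≤n)
open import Data.Nat.DivMod using ([m+n]%n≡m%n)
open import Data.Product using (_,_)
open import Data.Sum using (_⊎_; inj₁; inj₂)
open import Function using (_∘_; id)
open import Relation.Binary.PropositionalEquality
  using (_≢_; refl; sym; trans; cong; cong₂; module ≡-Reasoning)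
open import Relation.Nullary.Decidable using (does; dec-false)
import Data.Nat.Properties as ℕ
import Data.Integer.Properties as ℤ

open import Algebra.Properties.CommutativeSemigroup ℕ.+-commutativeSemigroup
  using (xy∙z≈xz∙y; x∙yz≈yx∙z)

open import Algebra.Properties.Semiring.Sum ℤ.+-*-semiring
  using (sum; sum-syntax; sum-cong-≗; sum-init-last; ∑-distrib-+; *-distribˡ-sum)

𝟙 : Bool → ℤ
𝟙 true  = + 1
𝟙 false = + 0

Periodic : {A : Set} → ℕ → (ℕ → A) → Set
Periodic n F = ∀ x → F (x + n) ≡ F x

periodic-+ : ∀ {A : Set} {n} {F : ℕ → A} → Periodic n F → ∀ k → Periodic n (λ x → F (x + k))
periodic-+ {F = F} periodic k x = trans (cong F (xy∙z≈xz∙y x _ k)) (periodic (x + k))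

∑-const-1 : ∀ n → ∑[ i < n ] (+ 1) ≡ + n
∑-const-1 zero    = refl
∑-const-1 (suc n) = cong (+ 1 +ℤ_) (∑-const-1 n)

foldr-tabulate : ∀ n (f : Fin n → ℤ) → foldr _+ℤ_ (+ 0) (tabulate f) ≡ sum f
foldr-tabulate zero    f = refl
foldr-tabulate (suc n) f = cong (f zero +ℤ_) (foldr-tabulate n (f ∘ suc))

Σℤ≡sum : ∀ n (f : Fin n → ℤ) → Σℤ n f ≡ sum f
Σℤ≡sum n f = trans (cong (foldr _+ℤ_ (+ 0)) (map-tabulate id f)) (foldr-tabulate n f)

length-filter-tabulate : ∀ {A : Set} n (f : Fin n → A) (p : A → Bool) →
  + length (filter (T? ∘ p) (tabulate f)) ≡ ∑[ i < n ] 𝟙 (p (f i))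
length-filter-tabulate zero    f p = refl
length-filter-tabulate (suc n) f p with p (f zero)
... | true  = cong (+ 1 +ℤ_) (length-filter-tabulate n (f ∘ suc) p)
... | false = trans (length-filter-tabulate n (f ∘ suc) p) (sym (ℤ.+-identityˡ _))

count≡∑𝟙 : ∀ n (p : Fin n → Bool) → + count n p ≡ ∑[ i < n ] 𝟙 (p i)
count≡∑𝟙 n p = length-filter-tabulate n id p

∑-rotate₁ : ∀ n (F : ℕ → ℤ) → F n ≡ F 0 → ∑[ i < n ] F (suc (toℕ i)) ≡ ∑[ i < n ] F (toℕ i)
∑-rotate₁ zero    F _ = refl
∑-rotate₁ (suc n) F Fn≡F0 = begin
  ∑[ i < suc n ] F (suc (toℕ i))
    ≡⟨ sum-init-last {n} (F ∘ suc ∘ toℕ) ⟩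
  ∑[ i < n ] F (suc (toℕ (inject₁ i))) +ℤ F (suc (toℕ (fromℕ n)))
    ≡⟨ cong₂ _+ℤ_ (sum-cong-≗ {n} (λ i → cong (F ∘ suc) (toℕ-inject₁ i)))
                  (trans (cong (F ∘ suc) (toℕ-fromℕ n)) Fn≡F0) ⟩
  ∑[ i < n ] F (suc (toℕ i)) +ℤ F 0
    ≡⟨ ℤ.+-comm (∑[ i < n ] F (suc (toℕ i))) (F 0) ⟩
  ∑[ i < suc n ] F (toℕ i) ∎
  where open ≡-Reasoning

∑-rotate : ∀ n (F : ℕ → ℤ) → Periodic n F → ∀ k → ∑[ i < n ] F (k + toℕ i) ≡ ∑[ i < n ] F (toℕ i)
∑-rotate n F periodic zero    = refl
∑-rotate n F periodic (suc k) =
  trans (∑-rotate n (F ∘ suc) (periodic ∘ suc) k) (∑-rotate₁ n F (periodic 0))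

count-rotate : ∀ n (P : ℕ → Bool) → Periodic n P → ∀ k →
  + count n (P ∘ toℕ) ≡ ∑[ i < n ] 𝟙 (P (k + toℕ i))
count-rotate n P periodic k =
  trans (count≡∑𝟙 n (P ∘ toℕ)) (sym (∑-rotate n (𝟙 ∘ P) (cong 𝟙 ∘ periodic) k))

IsSign : ℤ → Set
IsSign a = a ≡ + 1 ⊎ a ≡ - (+ 1)

_≠ᵇ_ : ℤ → ℤ → Bool
a ≠ᵇ b = not (does (a ≟ b))

-- (1 − ab)(1 − bc) = 4·[a ≠ b]·[b ≠ c], with the terms moved so that no subtraction occurs.
sign-changes : ∀ {a b c} → IsSign a → IsSign b → IsSign c →
  + 4 *ℤ 𝟙 ((b ≠ᵇ a) ∧ (c ≠ᵇ b)) +ℤ a *ℤ b +ℤ b *ℤ c ≡ + 1 +ℤ a *ℤ c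
sign-changes (inj₁ refl) (inj₁ refl) (inj₁ refl) = refl
sign-changes (inj₁ refl) (inj₁ refl) (inj₂ refl) = refl
sign-changes (inj₁ refl) (inj₂ refl) (inj₁ refl) = refl
sign-changes (inj₁ refl) (inj₂ refl) (inj₂ refl) = refl
sign-changes (inj₂ refl) (inj₁ refl) (inj₁ refl) = refl
sign-changes (inj₂ refl) (inj₁ refl) (inj₂ refl) = refl
sign-changes (inj₂ refl) (inj₂ refl) (inj₁ refl) = refl
sign-changes (inj₂ refl) (inj₂ refl) (inj₂ refl) = refl

≠ᵇ-xor : ∀ {a b c} → IsSign a → IsSign b → IsSign c → (c ≠ᵇ a) ≡ (b ≠ᵇ a) xor (c ≠ᵇ b)
≠ᵇ-xor (inj₁ refl) (inj₁ refl) (inj₁ refl) = refl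
≠ᵇ-xor (inj₁ refl) (inj₁ refl) (inj₂ refl) = refl
≠ᵇ-xor (inj₁ refl) (inj₂ refl) (inj₁ refl) = refl
≠ᵇ-xor (inj₁ refl) (inj₂ refl) (inj₂ refl) = refl
≠ᵇ-xor (inj₂ refl) (inj₁ refl) (inj₁ refl) = refl
≠ᵇ-xor (inj₂ refl) (inj₁ refl) (inj₂ refl) = refl
≠ᵇ-xor (inj₂ refl) (inj₂ refl) (inj₁ refl) = refl
≠ᵇ-xor (inj₂ refl) (inj₂ refl) (inj₂ refl) = refl

𝟙-xor-split : ∀ x y z → 𝟙 (x ∧ not y ∧ z) +ℤ 𝟙 ((y ∧ z) ∧ not (x ∧ y)) ≡ 𝟙 ((x xor y) ∧ z)
𝟙-xor-split true  true  true  = refl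
𝟙-xor-split true  true  false = refl
𝟙-xor-split true  false true  = refl
𝟙-xor-split true  false false = refl
𝟙-xor-split false true  true  = refl
𝟙-xor-split false true  false = refl
𝟙-xor-split false false true  = refl
𝟙-xor-split false false false = refl

module PeriodicSequence (n : ℕ) (g : ℕ → ℤ) (periodic : Periodic n g) where

  autocorrelation : ℕ → ℤ
  autocorrelation k = ∑[ i < n ] (g (toℕ i) *ℤ g (k + toℕ i))

  changesAt : ℕ → ℕ → ℕ → Bool
  changesAt p q x = (g (p + x) ≠ᵇ g x) ∧ (g (q + (p + x)) ≠ᵇ g (p + x))

  autocorrelation-rotate : ∀ p k →
    ∑[ i < n ] (g (p + toℕ i) *ℤ g (k + (p + toℕ i))) ≡ autocorrelation k
  autocorrelation-rotate p k = ∑-rotate n (λ x → g x *ℤ g (k + x)) product-periodic p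
    where
    product-periodic : Periodic n (λ x → g x *ℤ g (k + x))
    product-periodic x =
      cong₂ _*ℤ_ (periodic x) (trans (cong g (sym (ℕ.+-assoc k x n))) (periodic (k + x)))

  changesAt-autocorrelation : (∀ x → IsSign (g x)) → ∀ p q →
    + 4 *ℤ ∑[ i < n ] 𝟙 (changesAt p q (toℕ i)) +ℤ autocorrelation p +ℤ autocorrelation q
      ≡ + n +ℤ autocorrelation (p + q)
  changesAt-autocorrelation signs p q = begin
    + 4 *ℤ ∑[ i < n ] 𝟙 (C i) +ℤ ∑[ i < n ] (a i *ℤ b i) +ℤ autocorrelation q
      ≡⟨ cong₂ _+ℤ_ (cong (_+ℤ ∑[ i < n ] (a i *ℤ b i)) (*-distribˡ-sum (+ 4) (𝟙 ∘ C)))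
                    (sym (autocorrelation-rotate p q)) ⟩
    ∑[ i < n ] (+ 4 *ℤ 𝟙 (C i)) +ℤ ∑[ i < n ] (a i *ℤ b i) +ℤ ∑[ i < n ] (b i *ℤ c i)
      ≡⟨ cong (_+ℤ ∑[ i < n ] (b i *ℤ c i))
              (∑-distrib-+ (λ i → + 4 *ℤ 𝟙 (C i)) (λ i → a i *ℤ b i)) ⟨
    ∑[ i < n ] (+ 4 *ℤ 𝟙 (C i) +ℤ a i *ℤ b i) +ℤ ∑[ i < n ] (b i *ℤ c i)
      ≡⟨ ∑-distrib-+ (λ i → + 4 *ℤ 𝟙 (C i) +ℤ a i *ℤ b i) (λ i → b i *ℤ c i) ⟨
    ∑[ i < n ] (+ 4 *ℤ 𝟙 (C i) +ℤ a i *ℤ b i +ℤ b i *ℤ c i)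
      ≡⟨ sum-cong-≗ {n} (λ i → sign-changes (signs _) (signs _) (signs _)) ⟩
    ∑[ i < n ] (+ 1 +ℤ a i *ℤ c i)
      ≡⟨ ∑-distrib-+ (λ _ → + 1) (λ i → a i *ℤ c i) ⟩
    ∑[ i < n ] (+ 1) +ℤ ∑[ i < n ] (a i *ℤ c i)
      ≡⟨ cong₂ _+ℤ_ (∑-const-1 n)
                    (sum-cong-≗ {n} (λ i → cong (λ y → a i *ℤ g y) (x∙yz≈yx∙z q p (toℕ i)))) ⟩
    + n +ℤ autocorrelation (p + q) ∎
    where
    open ≡-Reasoning
    C : Fin n → Bool
    C i = changesAt p q (toℕ i)
    a b c : Fin n → ℤ
    a i = g (toℕ i)
    b i = g (p + toℕ i)
    c i = g (q + (p + toℕ i))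

  changesAt-uncorrelated : (∀ x → IsSign (g x)) → ∀ {p q} →
    autocorrelation p ≡ + 0 → autocorrelation q ≡ + 0 → autocorrelation (p + q) ≡ + 0 →
    + 4 *ℤ ∑[ i < n ] 𝟙 (changesAt p q (toℕ i)) ≡ + n
  changesAt-uncorrelated signs {p} {q} Rp≡0 Rq≡0 Rp+q≡0 = begin
    S                                               ≡⟨ ℤ.+-identityʳ S ⟨
    S +ℤ + 0                                        ≡⟨ ℤ.+-identityʳ (S +ℤ + 0) ⟨
    S +ℤ + 0 +ℤ + 0                                 ≡⟨ cong₂ (λ r s → S +ℤ r +ℤ s) Rp≡0 Rq≡0 ⟨
    S +ℤ autocorrelation p +ℤ autocorrelation q     ≡⟨ changesAt-autocorrelation signs p q ⟩
    + n +ℤ autocorrelation (p + q)                  ≡⟨ cong (+ n +ℤ_) Rp+q≡0 ⟩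
    + n +ℤ + 0                                      ≡⟨ ℤ.+-identityʳ (+ n) ⟩
    + n                                             ∎
    where
    open ≡-Reasoning
    S : ℤ
    S = + 4 *ℤ ∑[ i < n ] 𝟙 (changesAt p q (toℕ i))

at-periodic : ∀ n .{{_ : NonZero n}} (h : Fin n → ℤ) → Periodic n (at n h)
at-periodic n h x = cong h (fromℕ<-cong _ _ ([m+n]%n≡m%n x n) _ _)

circulant-autocorrelation : ∀ n .{{_ : NonZero n}} (h : Fin n → ℤ) → RowsOrthogonal n (circ n h) →
  ∀ {k} → 0 < k → k < n → PeriodicSequence.autocorrelation n (at n h) (at-periodic n h) k ≡ + 0
circulant-autocorrelation n@(suc _) h orthogonal {k} 0<k k<n = begin
  autocorrelation k
    ≡⟨ autocorrelation-rotate (n ∸ k) k ⟨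
  ∑[ i < n ] (g (n ∸ k + toℕ i) *ℤ g (k + (n ∸ k + toℕ i)))
    ≡⟨ sum-cong-≗ {n} row-entries ⟩
  ∑[ j < n ] (circ n h zero j *ℤ circ n h k′ j)
    ≡⟨ Σℤ≡sum n (λ j → circ n h zero j *ℤ circ n h k′ j) ⟨
  Σℤ n (λ j → circ n h zero j *ℤ circ n h k′ j)
    ≡⟨ orthogonal zero k′ zero≢k′ ⟩
  + 0 ∎
  where
  open ≡-Reasoning
  open PeriodicSequence n (at n h) (at-periodic n h)
  g : ℕ → ℤ
  g = at n h
  k′ : Fin n
  k′ = fromℕ< k<n
  zero≢k′ : zero ≢ k′
  zero≢k′ eq = ℕ.<-irrefl (trans (cong toℕ eq) (toℕ-fromℕ< k<n)) 0<k
  row-entries : ∀ i →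
    g (n ∸ k + toℕ i) *ℤ g (k + (n ∸ k + toℕ i)) ≡ circ n h zero i *ℤ circ n h k′ i
  row-entries i = trans (ℤ.*-comm (g (n ∸ k + toℕ i)) _) (cong₂ _*ℤ_
    (cong g (begin
      k + (n ∸ k + toℕ i)  ≡⟨ ℕ.+-assoc k (n ∸ k) (toℕ i) ⟨
      k + (n ∸ k) + toℕ i  ≡⟨ cong (_+ toℕ i) (ℕ.m+[n∸m]≡n (ℕ.<⇒≤ k<n)) ⟩
      n + toℕ i            ≡⟨ ℕ.+-comm n (toℕ i) ⟩
      toℕ i + n            ∎))
    (cong g (begin
      n ∸ k + toℕ i        ≡⟨ ℕ.+-comm (n ∸ k) (toℕ i) ⟩
      toℕ i + (n ∸ k)      ≡⟨ cong (λ t → toℕ i + (n ∸ t)) (toℕ-fromℕ< k<n) ⟨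
      toℕ i + (n ∸ toℕ k′) ∎)))

module BlockCounts (n : ℕ) .{{_ : NonZero n}} (h : Fin n → ℤ) where
  open Blocks n h
  open PeriodicSequence n (at n h) (at-periodic n h)

  private
    g : ℕ → ℤ
    g = at n h

  at-suc-pred : ∀ x → g (suc x + (n ∸ 1)) ≡ g x
  at-suc-pred x = trans (cong g suc-x+[n∸1]≡x+n) (at-periodic n h x)
    where
    suc-x+[n∸1]≡x+n : suc x + (n ∸ 1) ≡ x + n
    suc-x+[n∸1]≡x+n = trans (sym (ℕ.+-suc x (n ∸ 1))) (cong (λ y → x + y) (ℕ.suc-pred n))

  isStart-suc : ∀ x → isStart (suc x) ≡ (g (suc x) ≠ᵇ g x)
  isStart-suc x = cong (g (suc x) ≠ᵇ_) (at-suc-pred x)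

  isStart-shift : ∀ k x → isStart (suc x + k) ≡ (g (suc k + x) ≠ᵇ g (k + x))
  isStart-shift k x =
    trans (cong isStart (trans (ℕ.+-comm (suc x) k) (ℕ.+-suc k x))) (isStart-suc (k + x))

  size1At-suc : ∀ x → size1At (suc x) ≡ changesAt 1 1 x
  size1At-suc x = cong₂ _∧_ (isStart-suc x) (isStart-shift 1 x)

  size2At-suc : ∀ x →
    size2At (suc x) ≡ (g (1 + x) ≠ᵇ g x) ∧ not (g (2 + x) ≠ᵇ g (1 + x)) ∧ (g (3 + x) ≠ᵇ g (2 + x))
  size2At-suc x =
    cong₂ _∧_ (isStart-suc x) (cong₂ _∧_ (cong not (isStart-shift 1 x)) (isStart-shift 2 x))

  altStartAt-suc² : ∀ x → altStartAt (2 + x) ≡ changesAt 1 1 (1 + x) ∧ not (changesAt 1 1 x)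
  altStartAt-suc² x =
    cong₂ _∧_ (size1At-suc (suc x))
              (cong not (trans (size1At-suc (suc x + (n ∸ 1))) changesAt-pred))
    where
    changesAt-pred : changesAt 1 1 (suc x + (n ∸ 1)) ≡ changesAt 1 1 x
    changesAt-pred = cong₂ _∧_ (cong₂ _≠ᵇ_ (at-suc-pred (1 + x)) (at-suc-pred x))
                               (cong₂ _≠ᵇ_ (at-suc-pred (2 + x)) (at-suc-pred (1 + x)))

  size2-or-altStart : (∀ x → IsSign (g x)) → ∀ x →
    𝟙 (size2At (1 + x)) +ℤ 𝟙 (altStartAt (2 + x)) ≡ 𝟙 (changesAt 2 1 x)
  size2-or-altStart signs x = begin
    𝟙 (size2At (1 + x)) +ℤ 𝟙 (altStartAt (2 + x))
      ≡⟨ cong₂ (λ s t → 𝟙 s +ℤ 𝟙 t) (size2At-suc x) (altStartAt-suc² x) ⟩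
    𝟙 (u ∧ not v ∧ w) +ℤ 𝟙 ((v ∧ w) ∧ not (u ∧ v))
      ≡⟨ 𝟙-xor-split u v w ⟩
    𝟙 ((u xor v) ∧ w)
      ≡⟨ cong (λ b → 𝟙 (b ∧ w)) (≠ᵇ-xor (signs x) (signs (1 + x)) (signs (2 + x))) ⟨
    𝟙 (changesAt 2 1 x) ∎
    where
    open ≡-Reasoning
    u v w : Bool
    u = g (1 + x) ≠ᵇ g x
    v = g (2 + x) ≠ᵇ g (1 + x)
    w = g (3 + x) ≠ᵇ g (2 + x)

  isStart-periodic : Periodic n isStart
  isStart-periodic x = cong₂ _≠ᵇ_ (at-periodic n h x) (periodic-+ (at-periodic n h) (n ∸ 1) x)

  size1At-periodic : Periodic n size1At
  size1At-periodic x = cong₂ _∧_ (isStart-periodic x) (periodic-+ isStart-periodic 1 x)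

  size2At-periodic : Periodic n size2At
  size2At-periodic x = cong₂ _∧_ (isStart-periodic x)
    (cong₂ _∧_ (cong not (periodic-+ isStart-periodic 1 x)) (periodic-+ isStart-periodic 2 x))

  altStartAt-periodic : Periodic n altStartAt
  altStartAt-periodic x =
    cong₂ _∧_ (size1At-periodic x) (cong not (periodic-+ size1At-periodic (n ∸ 1) x))

  count-size1At : + count n (size1At ∘ toℕ) ≡ ∑[ i < n ] 𝟙 (changesAt 1 1 (toℕ i))
  count-size1At = trans (count-rotate n size1At size1At-periodic 1)
                        (sum-cong-≗ {n} (λ i → cong 𝟙 (size1At-suc (toℕ i))))

  count-size2At+altStartAt : (∀ x → IsSign (g x)) →
    + numBlocks2 +ℤ + count n (altStartAt ∘ toℕ) ≡ ∑[ i < n ] 𝟙 (changesAt 2 1 (toℕ i))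
  count-size2At+altStartAt signs = begin
    + numBlocks2 +ℤ + count n (altStartAt ∘ toℕ)
      ≡⟨ cong₂ _+ℤ_ (count-rotate n size2At size2At-periodic 1)
                    (count-rotate n altStartAt altStartAt-periodic 2) ⟩
    ∑[ i < n ] 𝟙 (size2At (1 + toℕ i)) +ℤ ∑[ i < n ] 𝟙 (altStartAt (2 + toℕ i))
      ≡⟨ ∑-distrib-+ {n} (λ i → 𝟙 (size2At (1 + toℕ i))) (λ i → 𝟙 (altStartAt (2 + toℕ i))) ⟨
    ∑[ i < n ] (𝟙 (size2At (1 + toℕ i)) +ℤ 𝟙 (altStartAt (2 + toℕ i)))
      ≡⟨ sum-cong-≗ {n} (λ i → size2-or-altStart signs (toℕ i)) ⟩
    ∑[ i < n ] 𝟙 (changesAt 2 1 (toℕ i)) ∎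
    where open ≡-Reasoning

  alpha1≡#altStarts : count n (size1At ∘ toℕ) ≢ n → alpha1 ≡ count n (altStartAt ∘ toℕ)
  alpha1≡#altStarts ≢n = cong (λ b → if b then 1 else count n (altStartAt ∘ toℕ))
                              (dec-false (count n (size1At ∘ toℕ) ℕ.≟ n) ≢n)

module CirculantHadamard (n : ℕ) .{{_ : NonZero n}} (h : Fin n → ℤ) (4≤n : 4 ≤ n)
                         (signs : PlusMinusOne n h) (orthogonal : RowsOrthogonal n (circ n h)) where
  open Blocks n h
  open BlockCounts n h
  open PeriodicSequence n (at n h) (at-periodic n h)
  open ≡-Reasoning

  private
    at-signs : ∀ x → IsSign (at n h x)
    at-signs x = signs _

    autocorrelation≡0 : ∀ {k} → 0 < k → k < 4 → autocorrelation k ≡ + 0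
    autocorrelation≡0 0<k k<4 =
      circulant-autocorrelation n h orthogonal 0<k (ℕ.<-≤-trans k<4 4≤n)

    R₁≡0 : autocorrelation 1 ≡ + 0
    R₁≡0 = autocorrelation≡0 (s≤s z≤n) (s≤s (s≤s z≤n))

    R₂≡0 : autocorrelation 2 ≡ + 0
    R₂≡0 = autocorrelation≡0 (s≤s z≤n) (s≤s (s≤s (s≤s z≤n)))

    R₃≡0 : autocorrelation 3 ≡ + 0
    R₃≡0 = autocorrelation≡0 (s≤s z≤n) ℕ.≤-refl

  4*#size1≡n : 4 * count n (size1At ∘ toℕ) ≡ n
  4*#size1≡n = ℤ.+-injective (begin
    + (4 * count n (size1At ∘ toℕ))             ≡⟨ ℤ.pos-* 4 (count n (size1At ∘ toℕ)) ⟩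
    + 4 *ℤ + count n (size1At ∘ toℕ)            ≡⟨ cong (+ 4 *ℤ_) count-size1At ⟩
    + 4 *ℤ ∑[ i < n ] 𝟙 (changesAt 1 1 (toℕ i))
      ≡⟨ changesAt-uncorrelated at-signs R₁≡0 R₁≡0 R₂≡0 ⟩
    + n                                          ∎)

  4*[#size2+#altStarts]≡n : 4 * (numBlocks2 + count n (altStartAt ∘ toℕ)) ≡ n
  4*[#size2+#altStarts]≡n = ℤ.+-injective (begin
    + (4 * (numBlocks2 + count n (altStartAt ∘ toℕ)))
      ≡⟨ ℤ.pos-* 4 (numBlocks2 + count n (altStartAt ∘ toℕ)) ⟩
    + 4 *ℤ + (numBlocks2 + count n (altStartAt ∘ toℕ))
      ≡⟨ cong (+ 4 *ℤ_) (ℤ.pos-+ numBlocks2 (count n (altStartAt ∘ toℕ))) ⟩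
    + 4 *ℤ (+ numBlocks2 +ℤ + count n (altStartAt ∘ toℕ))
      ≡⟨ cong (+ 4 *ℤ_) (count-size2At+altStartAt at-signs) ⟩
    + 4 *ℤ ∑[ i < n ] 𝟙 (changesAt 2 1 (toℕ i))
      ≡⟨ changesAt-uncorrelated at-signs R₂≡0 R₁≡0 R₃≡0 ⟩
    + n ∎)

  not-all-size1 : count n (size1At ∘ toℕ) ≢ n
  not-all-size1 #size1≡n = 4≢1 (ℕ.*-cancelʳ-≡ 4 1 n (begin
    4 * n                          ≡⟨ cong (4 *_) #size1≡n ⟨
    4 * count n (size1At ∘ toℕ)    ≡⟨ 4*#size1≡n ⟩
    n                              ≡⟨ ℕ.*-identityˡ n ⟨
    1 * n                          ∎))
    where
    4≢1 : 4 ≢ 1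
    4≢1 ()

n≡4m∧1<n⇒4≤n : ∀ {n} m → n ≡ 4 * m → 1 < n → 4 ≤ n
n≡4m∧1<n⇒4≤n zero    refl ()
n≡4m∧1<n⇒4≤n (suc m) refl _ = ℕ.m≤m*n 4 (suc m)

lemma3 : (n m : ℕ) .{{_ : NonZero n}} → n ≡ 4 * m → 1 < n → (h : Fin n → ℤ) →
         IsCirculantHadamard n h →
         Blocks.numBlocks2 n h + Blocks.alpha1 n h ≡ m
lemma3 n m n≡4m 1<n h (signs , orthogonal) = ℕ.*-cancelˡ-≡ _ m 4 (begin
  4 * (numBlocks2 + alpha1)
    ≡⟨ cong (λ a → 4 * (numBlocks2 + a)) (alpha1≡#altStarts not-all-size1) ⟩
  4 * (numBlocks2 + count n (altStartAt ∘ toℕ))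
    ≡⟨ 4*[#size2+#altStarts]≡n ⟩
  n
    ≡⟨ n≡4m ⟩
  4 * m ∎)
  where
  open ≡-Reasoning
  open Blocks n h
  open BlockCounts n h
  open CirculantHadamard n h (n≡4m∧1<n⇒4≤n m n≡4m 1<n) signs orthogonal
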